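{- The set $\mathrm{STConnComp}$ belongs to $\{\mathrm{NDPM}\}$, i.e. there exists a non-deterministic pointer machine that decides $\mathrm{STConnComp}$.
   Context: Inputs are binary words (integers $n$ given by binary words $a_1\cdots a_k$). A directed graph on nodes $1,\dots,m$ with adjacency matrix $(a_{ij})$ ($a_{ij}=1$ iff there is an edge from $i$ to $j$) is encoded by the binary word $0^m\,1\,(a_{11}0a_{12}0\cdots0a_{1m})\,1\,(a_{21}0\cdots0a_{2m})\,1\cdots1\,(a_{m1}0a_{m2}0\cdots0a_{mm})\,1$. $\mathrm{STConnComp}$ is the set of inputs $n$ that do not encode a graph in which there is a path from node $1$ to node $m$ (the last node). Non-deterministic pointer machines (NDPM): an NDPM with $p\ge1$ pointers is a pair $M=(Q,\to)$ with $Q$ a set of states and $\to\subseteq(\{0,1,\star\}^p\times Q)\times((I^p\times Q)\cup\{\mathbf{accept},\mathbf{reject}\})$, where the $i$-th component of an element of $I^p$ is one of $p_i+$ (move pointer $i$ one cell forward), $p_i-$ (one cell backward), $\epsilon_i$ (do not move). Elements of $\{0,1,\star\}^p\times Q$ are pseudo-configurations (the last values stored for each pointer and the current state; pointer addresses are not included). On input $n=a_1\cdots a_k$, the tape is circular and contains $\star a_1\cdots a_k$ (so $a_0=a_{k+1}=\star$). $M_c(n)$ denotes the run of $M$ started in pseudo-configuration $c$ with all pointers at address $0$ (on $\star$). At each step, from the current pseudo-configuration a transition in $\to$ is chosen non-deterministically (all choices are explored as branches); if its target is $\mathbf{accept}$ or $\mathbf{reject}$ the branch ends so; otherwise each pointer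 moves as instructed, each pointer that moved stores the symbol at its new position (stored values are updated only when the pointer moves), and the state changes; if no transition applies to the current pseudo-configuration, the branch accepts. $n$ is accepted by $M_c$ if after finitely many transitions every branch of $M_c(n)$ reaches accept, and rejected if at least one branch reaches reject. $M$ decides a set $S$ if there is a pseudo-configuration $c$ such that $M_c(n)$ accepts iff $n\in S$. $\{\mathrm{NDPM}\}$ is the class of sets decided by some NDPM. -}

module Defs where

open import Data.Nat using (ℕ; zero; suc; _+_)
open import Data.Nat.DivMod using (_mod_)
open import Data.Fin using (Fin; zero; suc; toℕ; fromℕ)
open import Data.Bool using (Bool; true; false)
open import Data.List using (List; []; _∷_; _++_; replicate; intersperse; concatMap; tabulate; length; lookup)
open import Data.List.Relation.Unary.All using (All)
open import Data.Vec using (Vec; zipWith)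
import Data.Vec
open import Data.Product using (Σ; _×_; _,_; proj₁; proj₂)
open import Data.Empty using (⊥)
open import Data.Unit using (⊤)
open import Relation.Nullary using (¬_)
open import Relation.Binary.PropositionalEquality using (_≡_)
open import Relation.Binary.Construct.Closure.ReflexiveTransitive using (Star)
open import Function.Bundles using (_⇔_)

-- Inputs: binary words, 0 = false, 1 = true

Word : Set
Word = List Bool

-- adjacency matrix of a directed graph on nodes 1..m (here Fin m, node 1 = zero)
Adj : ℕ → Set
Adj m = Fin m → Fin m → Bool

encRow : {m : ℕ} → Adj m → Fin m → Word
encRow {m} A i = intersperse false (tabulate {n = m} (A i))

-- 0^m 1 (row 1) 1 (row 2) 1 ... 1 (row m) 1
encode : (m : ℕ) → Adj m → Word
encode m A = replicate m false ++ (true ∷ concatMap (λ i → encRow A i ++ (true ∷ [])) (tabulate {n = m} (λ i → i)))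

-- edge relation and a path from node 1 to node m (m = suc k, last node = fromℕ k)
Edge : {m : ℕ} → Adj m → Fin m → Fin m → Set
Edge A i j = A i j ≡ true

HasPath1m : (k : ℕ) → Adj (suc k) → Set
HasPath1m k A = Star (Edge A) zero (fromℕ k)

EncodesConnected : Word → Set
EncodesConnected w = Σ ℕ λ k → Σ (Adj (suc k)) λ A → (w ≡ encode (suc k) A) × HasPath1m k A

STConnComp : Word → Set
STConnComp w = ¬ EncodesConnected w

data Sym : Set where
  s0 s1 ⋆ : Sym

data Move : Set where
  fwd bwd stay : Move

-- pseudo-configuration: stored values of the p pointers and the state (states = Fin q)
PseudoConfig : ℕ → ℕ → Set
PseudoConfig p q = Vec Sym p × Fin q

data Target (p q : ℕ) : Set where
  go     : Vec Move p → Fin q → Target p q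
  accept : Target p q
  reject : Target p q

Transition : ℕ → ℕ → Set
Transition p q = PseudoConfig p q × Target p q

NDPM : ℕ → ℕ → Set
NDPM p q = List (Transition p q)

-- the circular tape ⋆ a_1 ... a_k, addresses Fin (suc k)
bitSym : Bool → Sym
bitSym false = s0
bitSym true  = s1

tape : (w : Word) → Fin (suc (length w)) → Sym
tape w zero    = ⋆
tape w (suc i) = bitSym (lookup w i)

moveAddr : {L : ℕ} → Move → Fin (suc L) → Fin (suc L)
moveAddr {L} fwd  a = (toℕ a + 1) mod (suc L)
moveAddr {L} bwd  a = (toℕ a + L) mod (suc L)
moveAddr     stay a = a

newVal : (w : Word) → Move → Sym → Fin (suc (length w)) → Sym
newVal w stay v a = v
newVal w fwd  v a = tape w a
newVal w bwd  v a = tape w a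

Config : ℕ → ℕ → Word → Set
Config p q w = PseudoConfig p q × Vec (Fin (suc (length w))) p

step : {p q : ℕ} (w : Word) → Config p q w → Vec Move p → Fin q → Config p q w
step w ((vals , s) , addrs) ins s' =
  let addrs' = zipWith moveAddr ins addrs
  in (zipWith (λ f a → f a) (zipWith (newVal w) ins vals) addrs' , s') , addrs'

-- every branch from the configuration reaches accept after at most t transitions
-- (a branch with no applicable transition accepts)
mutual
  AcceptsIn : {p q : ℕ} → NDPM p q → (w : Word) → ℕ → Config p q w → Set
  AcceptsIn M w zero    cfg = All (λ tr → ¬ (proj₁ tr ≡ proj₁ cfg)) M
  AcceptsIn M w (suc t) cfg = All (λ tr → proj₁ tr ≡ proj₁ cfg → Outcome M w t cfg (proj₂ tr)) M

  Outcome : {p q : ℕ} → NDPM p q → (w : Word) → ℕ → Config p q w → Target p q → Set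
  Outcome M w t cfg (go ins s') = AcceptsIn M w t (step w cfg ins s')
  Outcome M w t cfg accept      = ⊤
  Outcome M w t cfg reject      = ⊥

Accepts : {p q : ℕ} → NDPM p q → PseudoConfig p q → Word → Set
Accepts {p} M c w = Σ ℕ λ t → AcceptsIn M w t (c , Data.Vec.replicate p zero)

Decides : {p q : ℕ} → NDPM p q → (Word → Set) → Set
Decides {p} {q} M S = Σ (PseudoConfig p q) λ c → (w : Word) → Accepts M c w ⇔ S w

-- S ∈ {NDPM}: decided by some NDPM with p ≥ 1 pointers
InNDPM : (Word → Set) → Set
InNDPM S = Σ ℕ λ p′ → Σ ℕ λ q → Σ (NDPM (suc p′) q) λ M → Decides M S

module Submission where

-- On input w the machine first checks, deterministically, that w
-- has the shape 0^m 1 (row 1) 1 ... 1 (row m) 1 of a graph encoding, using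
-- pointers as unary counters: a pointer standing on cell i of the header reads
-- 0 for 1 ≤ i ≤ m and 1 for i = m+1.  Malformed inputs are accepted.  On an
-- encoding it then walks through the graph from node 1: the current node and
-- a step counter are pointer positions in the header; in each step it guesses
-- a successor, looks the edge up in the matrix (accepting the branch if there
-- is none) and rejects as soon as the current node is the last one.  The step
-- counter makes every branch stop within m steps, so w is rejected iff there
-- is a walk of length < m from node 1 to node m, i.e. (after shortening
-- walks by the pigeonhole principle) iff there is a path at all.

open import Defs
open import Data.Nat using (ℕ; zero; suc; _+_; _≤_; _<_; _≤′_; ≤′-refl; ≤′-step; s≤s; z≤n; _%_; _∸_; _≤?_; _<?_)
open import Data.Nat.Properties
open import Data.Nat.DivMod using (m<n⇒m%n≡m; n%n≡0; [m+n]%n≡m%n)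
open import Data.Nat.Induction using (<-rec)
open import Data.Fin using (Fin; zero; suc; toℕ; fromℕ; fromℕ<; #_)
open import Data.Fin.Properties using (toℕ-fromℕ<; toℕ<n; toℕ-fromℕ; toℕ-injective; pigeonhole)
import Data.Fin as F
open import Data.Bool using (Bool; true; false)
open import Data.List using (List; []; _∷_; _++_; [_]; replicate; intersperse; concatMap; concat; map; tabulate; length; allFin)
open import Data.List.Properties using (length-++; length-replicate; ++-assoc; ++-identityʳ; map-tabulate; tabulate-cong)
open import Data.List.Relation.Unary.All as All using (All; []; _∷_)
import Data.List.Relation.Unary.All.Properties as AllP
import Data.List.Relation.Unary.Any as Any
open import Data.List.Relation.Unary.Any using (here; there)
open import Data.List.Membership.Propositional using (_∈_)
open import Data.List.Membership.Propositional.Properties using (∈-concatMap⁺; ∈-map⁺; ∈-allFin)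
open import Data.Vec using (Vec; zipWith; []; _∷_)
import Data.Vec as V
open import Data.Product using (Σ; _×_; _,_; proj₁; proj₂; ∃)
open import Data.Sum using (_⊎_; inj₁; inj₂)
open import Data.Empty using (⊥; ⊥-elim)
open import Data.Unit using (⊤; tt)
open import Relation.Nullary using (¬_; yes; no; Dec)
open import Relation.Binary.PropositionalEquality hiding ([_]; J)
open import Relation.Binary.Construct.Closure.ReflexiveTransitive using (Star; ε; _◅_; _◅◅_)
open import Relation.Binary.Definitions using (tri<; tri≈; tri>)
open import Function.Bundles using (mk⇔)
open import Data.Vec.Functional using () renaming (_∷_ to _◂_)

-- Accepting within t steps implies accepting within t+1 steps: a stopped
-- branch stays stopped and accept/reject outcomes do not change.
mutual
  acceptsIn-suc : ∀ {p q} (M : NDPM p q) w t cfg →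
                  AcceptsIn M w t cfg → AcceptsIn M w (suc t) cfg
  acceptsIn-suc M w zero    cfg h = All.map (λ stuck applies → ⊥-elim (stuck applies)) h
  acceptsIn-suc M w (suc t) cfg h = All.map (λ {tr} out applies → outcome-suc M w t cfg (proj₂ tr) (out applies)) h

  outcome-suc : ∀ {p q} (M : NDPM p q) w t cfg tg →
                Outcome M w t cfg tg → Outcome M w (suc t) cfg tg
  outcome-suc M w t cfg (go ins s′) h = acceptsIn-suc M w t _ h
  outcome-suc M w t cfg accept      h = tt
  outcome-suc M w t cfg reject      h = h

acceptsIn-mono : ∀ {p q} (M : NDPM p q) w {t t′} cfg → t ≤ t′ →
                 AcceptsIn M w t cfg → AcceptsIn M w t′ cfg
acceptsIn-mono M w {t} cfg t≤t′ h = lift (≤⇒≤′ t≤t′)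
  where
  lift : ∀ {u} → t ≤′ u → AcceptsIn M w u cfg
  lift ≤′-refl        = h
  lift (≤′-step t≤′u) = acceptsIn-suc M w _ cfg (lift t≤′u)

outcome-mono : ∀ {p q} (M : NDPM p q) w {t t′} cfg tg → t ≤ t′ →
               Outcome M w t cfg tg → Outcome M w t′ cfg tg
outcome-mono M w cfg (go ins s′) t≤t′ h = acceptsIn-mono M w _ t≤t′ h
outcome-mono M w cfg accept      t≤t′ h = tt
outcome-mono M w cfg reject      t≤t′ h = h

symVecs : (n : ℕ) → List (Vec Sym n)
symVecs zero    = [ [] ]
symVecs (suc n) = concatMap (λ s → map (s ∷_) (symVecs n)) (s0 ∷ s1 ∷ ⋆ ∷ [])

pseudoConfigs : (p q : ℕ) → List (PseudoConfig p q)
pseudoConfigs p q = concatMap (λ v → map (v ,_) (allFin q)) (symVecs p)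

∈-symVecs : ∀ {n} (v : Vec Sym n) → v ∈ symVecs n
∈-symVecs [] = here refl
∈-symVecs {suc n} (s ∷ v) = ∈-concatMap⁺ (λ s → map (s ∷_) (symVecs n)) (at s)
  where
  at : ∀ s → Any.Any (λ s′ → s ∷ v ∈ map (s′ ∷_) (symVecs n)) (s0 ∷ s1 ∷ ⋆ ∷ [])
  at s0 = here (∈-map⁺ (s0 ∷_) (∈-symVecs v))
  at s1 = there (here (∈-map⁺ (s1 ∷_) (∈-symVecs v)))
  at ⋆  = there (there (here (∈-map⁺ (⋆ ∷_) (∈-symVecs v))))

∈-pseudoConfigs : ∀ {p q} (c : PseudoConfig p q) → c ∈ pseudoConfigs p q
∈-pseudoConfigs (v , s) =
  ∈-concatMap⁺ (λ v → map (v ,_) (allFin _)) (Any.map (λ { refl → ∈-map⁺ (v ,_) (∈-allFin s) }) (∈-symVecs v))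

machine : ∀ {p q} → (PseudoConfig p q → List (Target p q)) → NDPM p q
machine δ = concatMap (λ c → map (c ,_) (δ c)) (pseudoConfigs _ _)

machine-all⁻ : ∀ {p q} (δ : PseudoConfig p q → List (Target p q)) {P : Transition p q → Set} →
               All P (machine δ) → ∀ c → All (λ tg → P (c , tg)) (δ c)
machine-all⁻ δ h c =
  AllP.map⁻ (All.lookup (AllP.map⁻ (AllP.concat⁻ {xss = map (λ c → map (c ,_) (δ c)) (pseudoConfigs _ _)} h))
                        (∈-pseudoConfigs c))

machine-all⁺ : ∀ {p q} (δ : PseudoConfig p q → List (Target p q)) {P : Transition p q → Set} →
               (∀ c → All (λ tg → P (c , tg)) (δ c)) → All P (machine δ)
machine-all⁺ δ h =
  AllP.concat⁺ {xss = map (λ c → map (c ,_) (δ c)) (pseudoConfigs _ _)}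
               (AllP.map⁺ (All.tabulate (λ {c} _ → AllP.map⁺ (h c))))

-- Walks in a graph on Fin m, as vertex sequences indexed by ℕ.  Every walk can be
-- shortened to one of length < m by cutting out a cycle found by the pigeonhole principle.
module Walks {m : ℕ} (E : Fin m → Fin m → Set) where

  Walk : Fin m → Fin m → ℕ → Set
  Walk a b ℓ = Σ (ℕ → Fin m) λ f → (f 0 ≡ a) × (f ℓ ≡ b) × (∀ t → t < ℓ → E (f t) (f (suc t)))

  star⇒walk : ∀ {a b} → Star E a b → ∃ (Walk a b)
  star⇒walk {a} ε = 0 , (λ _ → a) , refl , refl , λ t ()
  star⇒walk {a} (e ◅ rest) with star⇒walk rest
  ... | ℓ , g , g0 , gℓ , edges = suc ℓ , f , refl , gℓ , edges′
    where
    f : ℕ → Fin m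
    f zero    = a
    f (suc t) = g t
    edges′ : ∀ t → t < suc ℓ → E (f t) (f (suc t))
    edges′ zero    _         = subst (E a) (sym g0) e
    edges′ (suc t) (s≤s t<ℓ) = edges t t<ℓ

  skip : ℕ → ℕ → ℕ → ℕ
  skip i D t with t ≤? i
  ... | yes _ = t
  ... | no  _ = t + D

  skip-≤ : ∀ {i D t} → t ≤ i → skip i D t ≡ t
  skip-≤ {i} {D} {t} t≤i with t ≤? i
  ... | yes _  = refl
  ... | no t≰i = ⊥-elim (t≰i t≤i)

  skip-> : ∀ {i D t} → ¬ (t ≤ i) → skip i D t ≡ t + D
  skip-> {i} {D} {t} t≰i with t ≤? i
  ... | yes t≤i = ⊥-elim (t≰i t≤i)
  ... | no  _   = refl

  cutCycle : ∀ {a b} ℓ D i → (f : ℕ → Fin m) → f 0 ≡ a → f (ℓ + D) ≡ b →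
             (∀ t → t < ℓ + D → E (f t) (f (suc t))) → i ≤ ℓ → f i ≡ f (i + D) → Walk a b ℓ
  cutCycle {a} {b} ℓ D i f f0 fend edges i≤ℓ loop =
    (λ t → f (skip i D t)) , trans (cong f (skip-≤ {i} {D} {0} z≤n)) f0 , end (ℓ ≤? i) , edges′
    where
    end : Dec (ℓ ≤ i) → f (skip i D ℓ) ≡ b
    end (yes ℓ≤i) rewrite skip-≤ {i} {D} ℓ≤i | ≤-antisym ℓ≤i i≤ℓ = trans loop fend
    end (no  ℓ≰i) = trans (cong f (skip-> ℓ≰i)) fend
    edges′ : ∀ t → t < ℓ → E (f (skip i D t)) (f (skip i D (suc t)))
    edges′ t t<ℓ with <-cmp t i
    ... | tri< t<i _ _ rewrite skip-≤ {i} {D} (<⇒≤ t<i) | skip-≤ {i} {D} t<i =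
      edges t (≤-trans t<ℓ (m≤m+n ℓ D))
    ... | tri≈ _ refl _ rewrite skip-≤ {i} {D} (≤-refl {i}) | skip-> {i} {D} {suc i} 1+n≰n =
      subst (λ v → E v (f (suc i + D))) (sym loop) (edges (i + D) (+-monoˡ-< D t<ℓ))
    ... | tri> _ _ t>i rewrite skip-> {i} {D} (<⇒≱ t>i) | skip-> {i} {D} {suc t} (<⇒≱ (m<n⇒m<1+n t>i)) =
      edges (t + D) (+-monoˡ-< D t<ℓ)

  -- A walk of length ℓ ≥ m has m+1 vertices at times 0..m, two of which coincide.
  shorten : ∀ {a b} ℓ → Walk a b ℓ → ∃ λ ℓ′ → ℓ′ < m × Walk a b ℓ′
  shorten {a} {b} = <-rec (λ ℓ → Walk a b ℓ → ∃ λ ℓ′ → ℓ′ < m × Walk a b ℓ′) shorten′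
    where
    shorten′ : ∀ ℓ → (∀ {ℓ′} → ℓ′ < ℓ → Walk a b ℓ′ → ∃ λ ℓ″ → ℓ″ < m × Walk a b ℓ″) →
               Walk a b ℓ → ∃ λ ℓ′ → ℓ′ < m × Walk a b ℓ′
    shorten′ ℓ rec wk with ℓ <? m
    ... | yes ℓ<m = ℓ , ℓ<m , wk
    ... | no  ℓ≮m with wk | pigeonhole (n<1+n m) (λ (t : Fin (suc m)) → proj₁ wk (toℕ t))
    ... | f , f0 , fend , edges | x , y , x<y , same =
      rec ℓ′<ℓ (cutCycle ℓ′ D i f f0 (trans (cong f ℓ′+D≡ℓ) fend)
                            (λ t t< → edges t (subst (t <_) ℓ′+D≡ℓ t<)) i≤ℓ′
                            (trans same (cong f (sym i+D≡j))))
      where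
      i = toℕ x
      D = toℕ y ∸ i
      ℓ′ = ℓ ∸ D
      i+D≡j : i + D ≡ toℕ y
      i+D≡j = m+[n∸m]≡n (<⇒≤ x<y)
      j≤ℓ : toℕ y ≤ ℓ
      j≤ℓ = ≤-trans (≤-pred (toℕ<n y)) (≮⇒≥ ℓ≮m)
      ℓ′+D≡ℓ : ℓ′ + D ≡ ℓ
      ℓ′+D≡ℓ = m∸n+n≡m (≤-trans (m≤n+m D i) (subst (_≤ ℓ) (sym i+D≡j) j≤ℓ))
      i≤ℓ′ : i ≤ ℓ′
      i≤ℓ′ = +-cancelʳ-≤ D i ℓ′ (subst₂ _≤_ (sym i+D≡j) (sym ℓ′+D≡ℓ) j≤ℓ)
      ℓ′<ℓ : ℓ′ < ℓ
      ℓ′<ℓ = subst (ℓ′ <_) ℓ′+D≡ℓ (m<m+n ℓ′ (m<n⇒0<n∸m x<y))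

  shortWalk : ∀ {a b} → Star E a b → ∃ λ ℓ → ℓ < m × Walk a b ℓ
  shortWalk path = shorten _ (proj₂ (star⇒walk path))

-- Its seven pointers, in order:
--   P  scanning head              R  row counter (validation)
--   C  column counter (validation) N  current node (walk)
--   J  guessed successor (walk)    X  column seeker (walk)
--   K  step counter (walk)
-- Counters are read against the header 0^m 1: a counter on cell i reads 0 for
-- 1 ≤ i ≤ m, 1 for i = m + 1 and ⋆ for i = 0.
P R C N J X K : Fin 7
P = # 0
R = # 1
C = # 2
N = # 3
J = # 4
X = # 5
K = # 6

data St : Set where
  start readFirst scanHeader rowStart cellBit cellSep cellMore rowEnd rewindCol checkEnd : St
  -- walk: test the current node and the step budget, guess a successor j,
  -- locate row i of the matrix and its j-th cell, then return to the start
  walkStart atNode tick checkBudget guess seekMatrix seekRow skipBit skipSep : St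
  copyTarget cellStart seekCell nextCell rewind : St

stateList : Vec St 24
stateList = start ∷ readFirst ∷ scanHeader ∷ rowStart ∷ cellBit ∷ cellSep ∷ cellMore ∷ rowEnd ∷
            rewindCol ∷ checkEnd ∷ walkStart ∷ atNode ∷ tick ∷ checkBudget ∷ guess ∷ seekMatrix ∷
            seekRow ∷ skipBit ∷ skipSep ∷ copyTarget ∷ cellStart ∷ seekCell ∷ nextCell ∷ rewind ∷ []

state : Fin 24 → St
state = V.lookup stateList

code : St → Fin 24
code start       = # 0
code readFirst   = # 1
code scanHeader  = # 2
code rowStart    = # 3
code cellBit     = # 4
code cellSep     = # 5
code cellMore    = # 6
code rowEnd      = # 7
code rewindCol   = # 8
code checkEnd    = # 9
code walkStart   = # 10
code atNode      = # 11
code tick        = # 12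
code checkBudget = # 13
code guess       = # 14
code seekMatrix  = # 15
code seekRow     = # 16
code skipBit     = # 17
code skipSep     = # 18
code copyTarget  = # 19
code cellStart   = # 20
code seekCell    = # 21
code nextCell    = # 22
code rewind      = # 23

Tgt : Set
Tgt = Target 7 24

move : Fin 7 → Move → St → Tgt
move i m s = go (V.replicate 7 stay V.[ i ]≔ m) (code s)

advancePC copyStep : St → Tgt
advancePC s = go (fwd ∷ stay ∷ fwd ∷ stay ∷ stay ∷ stay ∷ stay ∷ []) (code s)
copyStep  s = go (stay ∷ stay ∷ stay ∷ fwd ∷ bwd ∷ fwd ∷ stay ∷ []) (code s)

ACC : List Tgt
ACC = [ accept ]

branch : Sym → List Tgt → List Tgt → List Tgt → List Tgt
branch s0 a b c = a
branch s1 a b c = b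
branch ⋆  a b c = c

branch-0 : ∀ {σ a b c} → σ ≡ s0 → branch σ a b c ≡ a
branch-0 refl = refl

branch-1 : ∀ {σ a b c} → σ ≡ s1 → branch σ a b c ≡ b
branch-1 refl = refl

branch-bit : ∀ {σ a c b} → σ ≡ bitSym b → branch σ a a c ≡ a
branch-bit {b = false} refl = refl
branch-bit {b = true}  refl = refl

transitions : St → Vec Sym 7 → List Tgt
transitions start       _ = [ move P fwd readFirst ]
-- the header must start with a 0 (m ≥ 1) and is scanned up to its closing 1
transitions readFirst   (p ∷ _) = branch p [ move P fwd scanHeader ] ACC ACC
transitions scanHeader  (p ∷ _) = branch p [ move P fwd scanHeader ] [ move R fwd rowStart ] ACC
-- R on a header 0: another row follows; on the closing 1: all m rows were read
transitions rowStart    (_ ∷ r ∷ _) = branch r [ advancePC cellBit ] [ move P fwd checkEnd ] ACC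
transitions cellBit     (p ∷ _) = branch p [ move P fwd cellSep ] [ move P fwd cellSep ] ACC
-- a separator 0 continues the row, a 1 ends it; C counts the cells read
transitions cellSep     (p ∷ _) = branch p [ move C fwd cellMore ] [ move C fwd rowEnd ] ACC
transitions cellMore    (_ ∷ _ ∷ c ∷ _) = branch c [ move P fwd cellBit ] ACC ACC
transitions rowEnd      (_ ∷ _ ∷ c ∷ _) = branch c ACC [ move C bwd rewindCol ] ACC
transitions rewindCol   (_ ∷ _ ∷ c ∷ _) = branch c [ move C bwd rewindCol ] ACC [ move R fwd rowStart ]
transitions checkEnd    (p ∷ _) = branch p ACC ACC [ move N fwd walkStart ]
-- N stands on cell i + 2 for the current node i (counted from 0)
transitions walkStart   _ = [ move N fwd atNode ]
transitions atNode      (_ ∷ _ ∷ _ ∷ n ∷ _) = branch n [ move N bwd tick ] [ reject ] ACC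
transitions tick        _ = [ move K fwd checkBudget ]
transitions checkBudget (_ ∷ _ ∷ _ ∷ _ ∷ _ ∷ _ ∷ k ∷ []) = branch k [ move J fwd guess ] ACC ACC
-- non-deterministic choice: move J further, or take the successor J − 1
transitions guess       (_ ∷ _ ∷ _ ∷ _ ∷ j ∷ _) = branch j (move J fwd guess ∷ move P fwd seekMatrix ∷ []) ACC ACC
transitions seekMatrix  (p ∷ _) = branch p [ move P fwd seekMatrix ] [ move N bwd seekRow ] ACC
-- skip one row per step of N back towards ⋆
transitions seekRow     (_ ∷ _ ∷ _ ∷ n ∷ _) = branch n [ move P fwd skipBit ] ACC [ copyStep copyTarget ]
transitions skipBit     _ = [ move P fwd skipSep ]
transitions skipSep     (p ∷ _) = branch p [ move P fwd skipBit ] [ move N bwd seekRow ] ACC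
-- move J back to ⋆, copying its position into N (the new node) and X
transitions copyTarget  (_ ∷ _ ∷ _ ∷ _ ∷ j ∷ _) = branch j [ copyStep copyTarget ] ACC [ move P fwd cellStart ]
transitions cellStart   _ = [ move X bwd seekCell ]
-- one cell per step of X back towards ⋆; there P reads the matrix entry
transitions seekCell    (p ∷ _ ∷ _ ∷ _ ∷ _ ∷ x ∷ _) =
  branch x [ move P fwd nextCell ] ACC (branch p ACC [ move P fwd rewind ] ACC)
transitions nextCell    _ = [ move P fwd cellStart ]
transitions rewind      (p ∷ _) = branch p [ move P fwd rewind ] [ move P fwd rewind ] [ move N fwd atNode ]

PC : Set
PC = PseudoConfig 7 24

δ : PC → List Tgt
δ (vals , s) = transitions (state s) vals

-- M is opaque: its transition list (one entry per pseudo-configuration) is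
-- never unfolded, and is only accessed through the two lemmas below.
opaque
  M : NDPM 7 24
  M = machine δ

  M-all⁻ : ∀ {P : Transition 7 24 → Set} → All P M → ∀ c → All (λ tg → P (c , tg)) (δ c)
  M-all⁻ = machine-all⁻ δ

  M-all⁺ : ∀ {P : Transition 7 24 → Set} → (∀ c → All (λ tg → P (c , tg)) (δ c)) → All P M
  M-all⁺ = machine-all⁺ δ

c₀ : PC
c₀ = V.replicate 7 ⋆ , code start

rowWord : (k : ℕ) → (Fin (suc k) → Bool) → Word
rowWord zero    f = f zero ∷ true ∷ []
rowWord (suc k) f = f zero ∷ false ∷ rowWord k (λ i → f (suc i))

rowsWord : (k n : ℕ) → (Fin n → Fin (suc k) → Bool) → Word
rowsWord k n G = concat (tabulate (λ i → rowWord k (G i)))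

encode-rows : ∀ k (A : Adj (suc k)) →
              encode (suc k) A ≡ replicate (suc k) false ++ true ∷ rowsWord k (suc k) A
encode-rows k A = cong (λ rows → replicate (suc k) false ++ true ∷ rows)
  (trans (cong concat (map-tabulate (λ i → i) (λ i → encRow A i ++ [ true ])))
         (cong concat (tabulate-cong (λ i → row (A i)))))
  where
  row : ∀ {k} (f : Fin (suc k) → Bool) → intersperse false (tabulate f) ++ [ true ] ≡ rowWord k f
  row {zero}  f = refl
  row {suc k} f = cong (λ u → f zero ∷ false ∷ u) (row (λ i → f (suc i)))

header-view : (u : Word) → (∃ λ n → u ≡ replicate n false) ⊎ (∃ λ n → ∃ λ B → u ≡ replicate n false ++ true ∷ B)
header-view []          = inj₁ (0 , refl)
header-view (true ∷ u)  = inj₂ (0 , u , refl)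
header-view (false ∷ u) with header-view u
... | inj₁ (n , e)     = inj₁ (suc n , cong (false ∷_) e)
... | inj₂ (n , B , e) = inj₂ (suc n , B , cong (false ∷_) e)

-- The symbol of w at (0-based) index i, ⋆ beyond its end.
bitAt : Word → ℕ → Sym
bitAt []      i       = ⋆
bitAt (b ∷ w) zero    = bitSym b
bitAt (b ∷ w) (suc i) = bitAt w i

lookup-bitAt : ∀ (u : Word) (i : Fin (length u)) → bitSym (Data.List.lookup u i) ≡ bitAt u (toℕ i)
lookup-bitAt (b ∷ u) zero    = refl
lookup-bitAt (b ∷ u) (suc i) = lookup-bitAt u i

Pos : Set
Pos = Vec ℕ 7

pos : (p r c n j x k : ℕ) → Pos
pos p r c n j x k = p ∷ r ∷ c ∷ n ∷ j ∷ x ∷ k ∷ []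

module Reposition (Q : Fin 24 → Pos → Set) where
  onP : ∀ {s p p′ r c n j x k} → p ≡ p′ → Q s (pos p′ r c n j x k) → Q s (pos p r c n j x k)
  onP refl q = q
  onR : ∀ {s p r r′ c n j x k} → r ≡ r′ → Q s (pos p r′ c n j x k) → Q s (pos p r c n j x k)
  onR refl q = q
  onC : ∀ {s p r c c′ n j x k} → c ≡ c′ → Q s (pos p r c′ n j x k) → Q s (pos p r c n j x k)
  onC refl q = q
  onN : ∀ {s p r c n n′ j x k} → n ≡ n′ → Q s (pos p r c n′ j x k) → Q s (pos p r c n j x k)
  onN refl q = q
  onJ : ∀ {s p r c n j j′ x k} → j ≡ j′ → Q s (pos p r c n j′ x k) → Q s (pos p r c n j x k)
  onJ refl q = q
  onX : ∀ {s p r c n j x x′ k} → x ≡ x′ → Q s (pos p r c n j x′ k) → Q s (pos p r c n j x k)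
  onX refl q = q
  onK : ∀ {s p r c n j x k k′} → k ≡ k′ → Q s (pos p r c n j x k′) → Q s (pos p r c n j x k)
  onK refl q = q

-- Counting loops are indexed by "remaining + current ≡ bound".
counter-≤ : ∀ {a b n} → a + b ≡ n → b ≤ n
counter-≤ {a} {b} e = subst (b ≤_) e (m≤n+m b a)

+-suc-suc : ∀ a b → a + suc (suc b) ≡ suc (suc (a + b))
+-suc-suc a b = trans (+-suc a (suc b)) (cong suc (+-suc a b))

module OnWord (w : Word) where

  L : ℕ
  L = length w

  Addr : Set
  Addr = Fin (suc L)

  tp : ℕ → Sym
  tp zero    = ⋆
  tp (suc i) = bitAt w i

  tape≡tp : (a : Addr) → tape w a ≡ tp (toℕ a)
  tape≡tp zero    = refl
  tape≡tp (suc i) = lookup-bitAt w i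

  shift : Move → ℕ → ℕ
  shift fwd  a = (a + 1) % suc L
  shift bwd  a = (a + L) % suc L
  shift stay a = a

  toℕ-moveAddr : ∀ m (a : Addr) → toℕ (moveAddr m a) ≡ shift m (toℕ a)
  toℕ-moveAddr fwd  a = toℕ-fromℕ< _
  toℕ-moveAddr bwd  a = toℕ-fromℕ< _
  toℕ-moveAddr stay a = refl

  shift-fwd : ∀ {a} → a < L → shift fwd a ≡ suc a
  shift-fwd {a} a<L = trans (cong (_% suc L) (+-comm a 1)) (m<n⇒m%n≡m (s≤s a<L))

  shift-fwd-end : shift fwd L ≡ 0
  shift-fwd-end = trans (cong (_% suc L) (+-comm L 1)) (n%n≡0 (suc L))

  shift-bwd : ∀ {a} → suc a ≤ L → shift bwd (suc a) ≡ a
  shift-bwd {a} a<L = trans (cong (_% suc L) (sym (+-suc a L)))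
    (trans ([m+n]%n≡m%n a (suc L)) (m<n⇒m%n≡m (s≤s (≤-trans (n≤1+n a) a<L))))

  -- A configuration is consistent when each stored value is the symbol under its
  -- pointer.  Runs from c₀ stay consistent, so it suffices to know the state and
  -- the pointer positions.
  consistent : Fin 24 → Vec Addr 7 → Config 7 24 w
  consistent s as = (V.map (tape w) as , s) , as

  positions : Vec Addr 7 → Pos
  positions = V.map toℕ

  positions-step : ∀ {n} (ins : Vec Move n) (as : Vec Addr n) →
                   V.map toℕ (zipWith moveAddr ins as) ≡ zipWith shift ins (V.map toℕ as)
  positions-step []        []       = refl
  positions-step (m ∷ ins) (a ∷ as) = cong₂ _∷_ (toℕ-moveAddr m a) (positions-step ins as)

  symbols : ∀ {n} (as : Vec Addr n) → V.map (tape w) as ≡ V.map tp (V.map toℕ as)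
  symbols []       = refl
  symbols (a ∷ as) = cong₂ _∷_ (tape≡tp a) (symbols as)

  step-consistent : ∀ s as ins s′ → step w (consistent s as) ins s′ ≡ consistent s′ (zipWith moveAddr ins as)
  step-consistent s as ins s′ = cong (λ v → (v , s′) , zipWith moveAddr ins as) (stored ins as)
    where
    stored : ∀ {n} (ins : Vec Move n) (as : Vec Addr n) →
      zipWith (λ f a → f a) (zipWith (newVal w) ins (V.map (tape w) as)) (zipWith moveAddr ins as) ≡
      V.map (tape w) (zipWith moveAddr ins as)
    stored []           []       = refl
    stored (fwd  ∷ ins) (a ∷ as) = cong (_ ∷_) (stored ins as)
    stored (bwd  ∷ ins) (a ∷ as) = cong (_ ∷_) (stored ins as)
    stored (stay ∷ ins) (a ∷ as) = cong (_ ∷_) (stored ins as)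

  moves : Fin 24 → Pos → List Tgt
  moves s xs = transitions (state s) (V.map tp xs)

  Good : Fin 24 → Pos → Set
  Good s xs = Σ ℕ λ t → ∀ as → positions as ≡ xs → AcceptsIn M w t (consistent s as)

  Rejecting : Fin 24 → Pos → Set
  Rejecting s xs = ∀ as → positions as ≡ xs → ∀ t → ¬ AcceptsIn M w t (consistent s as)

  GoodTarget : Pos → Tgt → Set
  GoodTarget xs (go ins s′) = Good s′ (zipWith shift ins xs)
  GoodTarget xs accept      = ⊤
  GoodTarget xs reject      = ⊥

  RejectingTarget : Pos → Tgt → Set
  RejectingTarget xs (go ins s′) = Rejecting s′ (zipWith shift ins xs)
  RejectingTarget xs accept      = ⊥
  RejectingTarget xs reject      = ⊤

  boundedTargets : ∀ s xs tgs → All (GoodTarget xs) tgs →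
    Σ ℕ λ t → All (λ tg → ∀ as → positions as ≡ xs → Outcome M w t (consistent s as) tg) tgs
  boundedTargets s xs []          []       = 0 , []
  boundedTargets s xs (tg ∷ tgs) (g ∷ gs) with bounded tg g | boundedTargets s xs tgs gs
    where
    bounded : ∀ tg → GoodTarget xs tg → Σ ℕ λ t → ∀ as → positions as ≡ xs → Outcome M w t (consistent s as) tg
    bounded (go ins s′) (t , h) = t , λ as eq → subst (AcceptsIn M w t) (sym (step-consistent s as ins s′))
      (h (zipWith moveAddr ins as) (trans (positions-step ins as) (cong (zipWith shift ins) eq)))
    bounded accept _ = 0 , λ _ _ → tt
  ... | t₁ , o | t₂ , os =
    t₁ + t₂ ,
    (λ as eq → outcome-mono M w (consistent s as) tg (m≤m+n t₁ t₂) (o as eq)) ∷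
    All.map (λ {tg′} h as eq → outcome-mono M w (consistent s as) tg′ (m≤n+m t₂ t₁) (h as eq)) os

  good-step : ∀ s xs {tgs} → moves s xs ≡ tgs → All (GoodTarget xs) tgs → Good s xs
  good-step s xs refl gs with boundedTargets s xs _ gs
  ... | t , os = suc t , λ as eq → M-all⁺ (λ c → All.tabulate (λ tg∈ applies → outcome as eq c applies tg∈))
    where
    outcome : ∀ {tg} as → positions as ≡ xs → ∀ c → c ≡ (V.map (tape w) as , s) → tg ∈ δ c →
              Outcome M w t (consistent s as) tg
    outcome as eq c refl tg∈ =
      All.lookup (subst (λ v → All _ (transitions (state s) v)) (sym (trans (symbols as) (cong (V.map tp) eq)))
                        (All.map (λ f → f as eq) os)) tg∈

  rejecting-step : ∀ s xs {tgs tg} → moves s xs ≡ tgs → tg ∈ tgs → RejectingTarget xs tg → Rejecting s xs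
  rejecting-step s xs {tg = tg} refl tg∈ r as eq t acc = refute t acc
    where
    available : tg ∈ δ (V.map (tape w) as , s)
    available = subst (λ v → tg ∈ transitions (state s) v) (sym (trans (symbols as) (cong (V.map tp) eq))) tg∈
    refute : ∀ t → ¬ AcceptsIn M w t (consistent s as)
    refute zero    acc = All.lookup (M-all⁻ acc _) available refl
    refute (suc t) acc = contradict tg r (All.lookup (M-all⁻ acc _) available refl)
      where
      contradict : ∀ tg → RejectingTarget xs tg → ¬ Outcome M w t (consistent s as) tg
      contradict (go ins s′) r o = r (zipWith moveAddr ins as)
        (trans (positions-step ins as) (cong (zipWith shift ins) eq)) t
        (subst (AcceptsIn M w t) (step-consistent s as ins s′) o)
      contradict accept () o
      contradict reject r o = o

  -- Predicates on positions closed under deterministic steps taken backwards.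
  -- Good and Rejecting are both of this kind, so the deterministic parts of
  -- the machine are analysed once for both.
  BackClosed : (Fin 24 → Pos → Set) → Set
  BackClosed Q = ∀ {s xs ins s′} → moves s xs ≡ [ go ins s′ ] → Q s′ (zipWith shift ins xs) → Q s xs

  good-back : BackClosed Good
  good-back {s} {xs} eq g = good-step s xs eq (g ∷ [])

  rejecting-back : BackClosed Rejecting
  rejecting-back {s} {xs} eq r = rejecting-step s xs eq (here refl) r

  good-accept : ∀ {s xs} → moves s xs ≡ ACC → Good s xs
  good-accept {s} {xs} eq = good-step s xs eq (tt ∷ [])
  -- Suffix p rest: the cells after cell p of the tape ⋆ w hold exactly rest.
  Suffix : ℕ → Word → Set
  Suffix p rest = Σ Word λ pre → (w ≡ pre ++ rest) × (length pre ≡ p)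

  suffix-head : ∀ {p b rest} → Suffix p (b ∷ rest) → tp (suc p) ≡ bitSym b
  suffix-head (pre , refl , refl) = read pre
    where
    read : ∀ {b rest} pre → bitAt (pre ++ b ∷ rest) (length pre) ≡ bitSym b
    read []        = refl
    read (x ∷ pre) = read pre

  suffix-< : ∀ {p b rest} → Suffix p (b ∷ rest) → p < L
  suffix-< {p} {b} {rest} (pre , refl , refl) =
    subst (length pre <_) (sym (length-++ pre)) (m<m+n (length pre) (s≤s z≤n))

  suffix-tail : ∀ {p b rest} → Suffix p (b ∷ rest) → Suffix (suc p) rest
  suffix-tail {p} {b} {rest} (pre , w≡ , refl) =
    pre ++ [ b ] , trans w≡ (sym (++-assoc pre [ b ] rest)) ,
    trans (length-++ pre) (+-comm (length pre) 1)

  suffix-drop : ∀ {p} xs {rest} → Suffix p (xs ++ rest) → Suffix (length xs + p) rest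
  suffix-drop {p} xs {rest} (pre , w≡ , refl) =
    pre ++ xs , trans w≡ (sym (++-assoc pre xs rest)) , trans (length-++ pre) (+-comm (length pre) (length xs))

  suffix-end : ∀ {p} → Suffix p [] → p ≡ L
  suffix-end (pre , refl , refl) = cong length (sym (++-identityʳ pre))

  -- Every row starts with a cell, so a position followed by a row is inside the word.
  suffix-<-row : ∀ {p} k f rest → Suffix p (rowWord k f ++ rest) → p < L
  suffix-<-row zero    f rest sp = suffix-< sp
  suffix-<-row (suc k) f rest sp = suffix-< sp

  inWord : ∀ {x} → 1 ≤ x → x ≤ L → ∃ λ b → tp x ≡ bitSym b
  inWord {suc i} _ i<L = bit w i i<L
    where
    bit : ∀ (u : Word) i → suc i ≤ length u → ∃ λ b → bitAt u i ≡ bitSym b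
    bit (b ∷ u) zero    _         = b , refl
    bit (b ∷ u) (suc i) (s≤s i<u) = bit u i i<u

  zeroPrefix : ∀ {n rest x} → w ≡ replicate n false ++ rest → 1 ≤ x → x ≤ n → tp x ≡ s0
  zeroPrefix {n} {rest} {suc i} refl _ i<n = zero′ n i i<n
    where
    zero′ : ∀ n i → suc i ≤ n → bitAt (replicate n false ++ rest) i ≡ s0
    zero′ (suc n) zero    _         = refl
    zero′ (suc n) (suc i) (s≤s i<n) = zero′ n i i<n

  module Header (k : ℕ) (B : Word) (w≡ : w ≡ replicate (suc k) false ++ true ∷ B) where

    m : ℕ
    m = suc k

    header-0 : ∀ {x} → 1 ≤ x → x ≤ m → tp x ≡ s0
    header-0 = zeroPrefix w≡

    header-suffix : Suffix m (true ∷ B)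
    header-suffix = replicate m false , w≡ , length-replicate m

    header-1 : tp (suc m) ≡ s1
    header-1 = suffix-head header-suffix

    rows-suffix : Suffix (suc m) B
    rows-suffix = suffix-tail header-suffix

    m<L : m < L
    m<L = suffix-< header-suffix

    0<L : 0 < L
    0<L = ≤-<-trans z≤n m<L

    counter-fwd : ∀ {x} → x ≤ m → shift fwd x ≡ suc x
    counter-fwd x≤m = shift-fwd (≤-<-trans x≤m m<L)

    counter-bwd : ∀ {x} → x ≤ m → shift bwd (suc x) ≡ x
    counter-bwd x≤m = shift-bwd (≤-trans (s≤s x≤m) m<L)

    module Validation (Q : Fin 24 → Pos → Set) (back : BackClosed Q) where
      open Reposition Q public

      scan-header : ∀ d x → d + x ≡ suc m → 1 ≤ x →
                    Q (code rowStart) (pos (suc m) 1 0 0 0 0 0) → Q (code scanHeader) (pos x 0 0 0 0 0 0)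
      scan-header zero    x refl _   q = back (branch-1 header-1) (onR (counter-fwd z≤n) q)
      scan-header (suc d) x e    1≤x q =
        back (branch-0 (header-0 1≤x x≤m)) (onP (counter-fwd x≤m) (scan-header d (suc x) (trans (+-suc d x) e) (s≤s z≤n) q))
        where
        x≤m : x ≤ m
        x≤m = counter-≤ (suc-injective e)

      header-run : Q (code rowStart) (pos (suc m) 1 0 0 0 0 0) → Q (code start) (pos 0 0 0 0 0 0 0)
      header-run q =
        back refl (onP (shift-fwd 0<L) (back (branch-0 (header-0 (s≤s z≤n) (s≤s z≤n)))
          (onP (counter-fwd (s≤s z≤n)) (scan-header k 2 (+-comm k 2) (s≤s z≤n) q))))

      cell-bit : ∀ {b rest p r c} → Suffix p (b ∷ rest) →
                 Q (code cellSep) (pos (shift fwd (suc p)) r c 0 0 0 0) → Q (code cellBit) (pos (suc p) r c 0 0 0 0)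
      cell-bit sp q = back (branch-bit (suffix-head sp)) q

      cell-inner : ∀ {b rest p r c} → Suffix p (b ∷ false ∷ rest) → suc c ≤ m →
                   Q (code cellBit) (pos (shift fwd (suc (suc p))) r (suc c) 0 0 0 0) →
                   Q (code cellBit) (pos (suc p) r c 0 0 0 0)
      cell-inner sp c<m q =
        cell-bit sp (onP (shift-fwd (suffix-< (suffix-tail sp))) (back (branch-0 (suffix-head (suffix-tail sp)))
          (onC (counter-fwd (<⇒≤ c<m)) (back (branch-0 (header-0 (s≤s z≤n) c<m)) q))))

      -- The last cell "b 1": C must reach the closing 1, so the row had exactly m cells.
      cell-last : ∀ {b rest p r} → Suffix p (b ∷ true ∷ rest) →
                  Q (code rewindCol) (pos (suc (suc p)) r m 0 0 0 0) → Q (code cellBit) (pos (suc p) r m 0 0 0 0)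
      cell-last sp q =
        cell-bit sp (onP (shift-fwd (suffix-< (suffix-tail sp))) (back (branch-1 (suffix-head (suffix-tail sp)))
          (onC (counter-fwd ≤-refl) (back (branch-1 header-1) (onC (counter-bwd ≤-refl) q)))))

      row-cells : ∀ kk f rest p c r → Suffix p (rowWord kk f ++ rest) → kk + c ≡ m →
                  Q (code rewindCol) (pos (length (rowWord kk f) + p) r m 0 0 0 0) →
                  Q (code cellBit) (pos (shift fwd p) r c 0 0 0 0)
      row-cells zero     f rest p c r sp refl q = onP (shift-fwd (suffix-< sp)) (cell-last sp q)
      row-cells (suc kk) f rest p c r sp e    q =
        onP (shift-fwd (suffix-< sp)) (cell-inner sp (counter-≤ (trans (+-suc kk c) e))
          (row-cells kk (λ i → f (suc i)) rest (suc (suc p)) (suc c) r (suffix-tail (suffix-tail sp)) (trans (+-suc kk c) e)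
            (onP (+-suc-suc (length (rowWord kk (λ i → f (suc i)))) p) q)))

      rewind-col : ∀ c p r → c ≤ m → Q (code rowStart) (pos p (shift fwd r) 0 0 0 0 0) → Q (code rewindCol) (pos p r c 0 0 0 0)
      rewind-col zero    p r _   q = back (refl) q
      rewind-col (suc c) p r c<m q =
        back (branch-0 (header-0 (s≤s z≤n) c<m)) (onC (counter-bwd (<⇒≤ c<m)) (rewind-col c p r (<⇒≤ c<m) q))

      row-begin : ∀ {p r} → 1 ≤ r → r ≤ m →
                  Q (code cellBit) (pos (shift fwd p) r 1 0 0 0 0) → Q (code rowStart) (pos p r 0 0 0 0 0)
      row-begin 1≤r r≤m q = back (branch-0 (header-0 1≤r r≤m)) (onC (shift-fwd 0<L) q)

      row-end : ∀ {p r} → r ≤ m → Q (code rowStart) (pos p (suc r) 0 0 0 0 0) → Q (code rewindCol) (pos p r m 0 0 0 0)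
      row-end {p} {r} r≤m q = rewind-col m p r ≤-refl (onR (counter-fwd r≤m) q)

      -- After m rows R reads the closing 1, and P must then be at the end of the word.
      rows-done : ∀ {p} → Suffix p [] →
                  Q (code walkStart) (pos 0 (suc m) 0 1 0 0 0) → Q (code rowStart) (pos p (suc m) 0 0 0 0 0)
      rows-done sp q =
        back (branch-1 header-1) (onP (trans (cong (shift fwd) (suffix-end sp)) shift-fwd-end)
          (back (refl) (onN (shift-fwd 0<L) q)))

      rows-run : ∀ nr G p r → Suffix p (rowsWord k nr G) → nr + r ≡ suc m → 1 ≤ r →
                 Q (code walkStart) (pos 0 (suc m) 0 1 0 0 0) → Q (code rowStart) (pos p r 0 0 0 0 0)
      rows-run zero     G p r sp refl _   q = rows-done sp q
      rows-run (suc nr) G p r sp e    1≤r q =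
        row-begin 1≤r r≤m (row-cells k (G zero) _ p 1 r sp (+-comm k 1)
          (row-end r≤m (rows-run nr (λ i → G (suc i)) _ (suc r) (suffix-drop (rowWord k (G zero)) sp)
                                 (trans (+-suc nr r) e) (s≤s z≤n) q)))
        where
        r≤m : r ≤ m
        r≤m = counter-≤ (suc-injective e)

    open Validation Good good-back public

    -- On an arbitrary continuation, the row phase is good as soon as it is
    -- good after every well-formed row.
    row-cells-good : ∀ kk p rest c r → Suffix p rest → kk + c ≡ m →
      (∀ f rest′ → rest ≡ rowWord kk f ++ rest′ → Good (code rewindCol) (pos (length (rowWord kk f) + p) r m 0 0 0 0)) →
      Good (code cellBit) (pos (shift fwd p) r c 0 0 0 0)
    row-cells-good kk p [] c r sp e H =
      onP (trans (cong (shift fwd) (suffix-end sp)) shift-fwd-end) (good-accept (refl))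
    row-cells-good kk p (b ∷ []) c r sp e H =
      onP (shift-fwd (suffix-< sp)) (cell-bit sp
        (onP (trans (cong (shift fwd) (suffix-end (suffix-tail sp))) shift-fwd-end) (good-accept (refl))))
    row-cells-good zero p (b ∷ false ∷ rest) c r sp refl H =
      onP (shift-fwd (suffix-< sp)) (cell-bit sp (onP (shift-fwd (suffix-< (suffix-tail sp)))
        (good-back (branch-0 (suffix-head (suffix-tail sp))) (onC (counter-fwd ≤-refl) (good-accept (branch-1 header-1))))))
    row-cells-good (suc kk) p (b ∷ false ∷ rest) c r sp e H =
      onP (shift-fwd (suffix-< sp)) (cell-inner sp (counter-≤ (trans (+-suc kk c) e))
        (row-cells-good kk (suc (suc p)) rest (suc c) r (suffix-tail (suffix-tail sp)) (trans (+-suc kk c) e)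
          (λ f rest′ eq → onP (+-suc-suc (length (rowWord kk f)) p) (H (b ◂ f) rest′ (cong (λ u → b ∷ false ∷ u) eq)))))
    row-cells-good zero p (b ∷ true ∷ rest) c r sp refl H =
      onP (shift-fwd (suffix-< sp)) (cell-last sp (H (λ _ → b) rest refl))
    row-cells-good (suc kk) p (b ∷ true ∷ rest) c r sp e H =
      onP (shift-fwd (suffix-< sp)) (cell-bit sp (onP (shift-fwd (suffix-< (suffix-tail sp)))
        (good-back (branch-1 (suffix-head (suffix-tail sp)))
          (onC (counter-fwd (<⇒≤ c<m)) (good-accept (branch-0 (header-0 (s≤s z≤n) c<m)))))))
      where
      c<m : suc c ≤ m
      c<m = counter-≤ (trans (+-suc kk c) e)

    rows-good : ∀ nr p rest r → Suffix p rest → nr + r ≡ suc m → 1 ≤ r →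
      (∀ G → rest ≡ rowsWord k nr G → Good (code walkStart) (pos 0 (suc m) 0 1 0 0 0)) →
      Good (code rowStart) (pos p r 0 0 0 0 0)
    rows-good zero p [] r sp refl _ H = rows-done sp (H (λ ()) refl)
    rows-good zero p (b ∷ rest) r sp refl _ H =
      good-back (branch-1 header-1) (onP (shift-fwd (suffix-< sp)) (good-accept (trailing b (suffix-head sp))))
      where
      trailing : ∀ b {σ} → σ ≡ bitSym b → branch σ ACC ACC [ move N fwd walkStart ] ≡ ACC
      trailing false refl = refl
      trailing true  refl = refl
    rows-good (suc nr) p rest r sp e 1≤r H =
      row-begin 1≤r r≤m (row-cells-good k p rest 1 r sp (+-comm k 1)
        (λ f rest′ eq → row-end r≤m (rows-good nr _ rest′ (suc r) (suffix-drop (rowWord k f) (subst (Suffix p) eq sp))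
                          (trans (+-suc nr r) e) (s≤s z≤n) (λ G eq′ → H (f ◂ G) (trans eq (cong (rowWord k f ++_) eq′))))))
      where
      r≤m : r ≤ m
      r≤m = counter-≤ (suc-injective e)

  -- The validation phase accepts every word that is not a graph encoding.
  header-zeros-good : ∀ {n} → w ≡ replicate n false → ∀ d x → d + x ≡ n → Good (code scanHeader) (pos (shift fwd x) 0 0 0 0 0 0)
  header-zeros-good {n} w≡ zero x refl =
    onP (trans (cong (shift fwd) x≡L) shift-fwd-end) (good-accept (refl))
    where
    open Reposition Good
    x≡L : x ≡ L
    x≡L = trans (sym (length-replicate x)) (cong length (sym w≡))
  header-zeros-good {n} w≡ (suc d) x e =
    onP (shift-fwd x<L) (good-back (branch-0 (zeroPrefix {n} {[]} (trans w≡ (sym (++-identityʳ _))) (s≤s z≤n) x<n))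
      (header-zeros-good w≡ d (suc x) (trans (+-suc d x) e)))
    where
    open Reposition Good
    x<n : suc x ≤ n
    x<n = counter-≤ (trans (+-suc d x) e)
    x<L : x < L
    x<L = subst (x <_) (trans (sym (length-replicate n)) (cong length (sym w≡))) x<n

  validation-good : (∀ k G → w ≡ replicate (suc k) false ++ true ∷ rowsWord k (suc k) G →
                             Good (code walkStart) (pos 0 (suc (suc k)) 0 1 0 0 0)) →
                    Good (code start) (pos 0 0 0 0 0 0 0)
  validation-good H = by-shape (header-view w)
    where
    open Reposition Good
    by-shape : (∃ λ n → w ≡ replicate n false) ⊎ (∃ λ n → ∃ λ B → w ≡ replicate n false ++ true ∷ B) →
               Good (code start) (pos 0 0 0 0 0 0 0)
    by-shape (inj₁ (zero , w≡)) = good-back refl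
      (onP (subst (λ u → shift fwd u ≡ 0) (cong length w≡) shift-fwd-end) (good-accept (refl)))
    by-shape (inj₁ (suc n , w≡)) = good-back refl
      (onP (shift-fwd (subst (0 <_) (cong length (sym w≡)) (s≤s z≤n)))
        (good-back (branch-0 (zeroPrefix {suc n} {[]} (trans w≡ (sym (++-identityʳ _))) (s≤s z≤n) (s≤s z≤n)))
          (header-zeros-good w≡ n 1 (+-comm n 1))))
    by-shape (inj₂ (zero , B , w≡)) = good-back refl
      (onP (shift-fwd (subst (0 <_) (cong length (sym w≡)) (s≤s z≤n))) (good-accept (branch-1 (cong (λ u → bitAt u 0) w≡))))
    by-shape (inj₂ (suc k , B , w≡)) =
      header-run (rows-good (suc k) (suc m) B 1 rows-suffix (cong suc (+-comm k 1)) (s≤s z≤n)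
        (λ G eq → H k G (trans w≡ (cong (λ u → replicate (suc k) false ++ true ∷ u) eq))))
      where open Header k B w≡

  -- Node i
  -- is represented by N on cell toℕ i + 2, a guessed successor j by J on cell
  -- toℕ j + 1, and the number of steps taken by K; R stays on cell m + 1.
  module Walk (k : ℕ) (A : Adj (suc k)) (w≡ : w ≡ replicate (suc k) false ++ true ∷ rowsWord k (suc k) A) where
    open Header k (rowsWord k (suc k) A) w≡
      using (m; header-0; header-1; rows-suffix; m<L; 0<L; counter-fwd; counter-bwd)

    rr : ℕ
    rr = suc m

    module Steps (Q : Fin 24 → Pos → Set) (back : BackClosed Q) where
      open Reposition Q

      to-guess : ∀ (i : Fin m) s → suc (suc (toℕ i)) ≤ m → s < m →
        Q (code guess) (pos 0 rr 0 (suc (toℕ i)) 1 0 (suc s)) → Q (code atNode) (pos 0 rr 0 (suc (suc (toℕ i))) 0 0 s)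
      to-guess i s i+2≤m s<m q =
        back (branch-0 (header-0 (s≤s z≤n) i+2≤m)) (onN (counter-bwd (<⇒≤ i+2≤m))
          (back refl (onK (counter-fwd (<⇒≤ s<m)) (back (branch-0 (header-0 (s≤s z≤n) s<m)) (onJ (shift-fwd 0<L) q)))))

      seek-matrix : ∀ d y {n j x s} → d + y ≡ suc m → 1 ≤ y →
        Q (code seekRow) (pos (suc m) rr 0 (shift bwd n) j x s) → Q (code seekMatrix) (pos y rr 0 n j x s)
      seek-matrix zero    y refl _   q = back (branch-1 header-1) q
      seek-matrix (suc d) y e    1≤y q =
        back (branch-0 (header-0 1≤y y≤m)) (onP (counter-fwd y≤m) (seek-matrix d (suc y) (trans (+-suc d y) e) (s≤s z≤n) q))
        where
        y≤m : y ≤ m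
        y≤m = counter-≤ (suc-injective e)

      skip-row : ∀ kk f rest p {n j x s} → Suffix p (rowWord kk f ++ rest) →
        Q (code seekRow) (pos (length (rowWord kk f) + p) rr 0 (shift bwd n) j x s) → Q (code skipBit) (pos (suc p) rr 0 n j x s)
      skip-row zero     f rest p sp q =
        back refl (onP (shift-fwd (suffix-< (suffix-tail sp))) (back (branch-1 (suffix-head (suffix-tail sp))) q))
      skip-row (suc kk) f rest p sp q =
        back refl (onP (shift-fwd (suffix-< (suffix-tail sp))) (back (branch-0 (suffix-head (suffix-tail sp)))
          (onP (shift-fwd (suffix-<-row kk _ rest next)) (skip-row kk (λ i → f (suc i)) rest (suc (suc p)) next
            (onP (+-suc-suc (length (rowWord kk (λ i → f (suc i)))) p) q)))))
        where
        next = suffix-tail (suffix-tail sp)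

      skip-rows : ∀ nr (G : Fin nr → Fin m → Bool) (i : Fin nr) p rest {j x s} → Suffix p (rowsWord k nr G ++ rest) → nr ≤ m →
        (∀ p′ rest′ → Suffix p′ (rowWord k (G i) ++ rest′) → Q (code seekRow) (pos p′ rr 0 0 j x s)) →
        Q (code seekRow) (pos p rr 0 (toℕ i) j x s)
      skip-rows (suc nr) G zero    p rest sp nr≤m H = H p _ (subst (Suffix p) (++-assoc (rowWord k (G zero)) _ rest) sp)
      skip-rows (suc nr) G (suc i) p rest sp nr≤m H =
        back (branch-0 (header-0 (s≤s z≤n) i<m)) (onP (shift-fwd (suffix-<-row k _ _ sp′))
          (skip-row k (G zero) _ p sp′ (onN (counter-bwd (<⇒≤ i<m))
            (skip-rows nr (λ i → G (suc i)) i _ rest (suffix-drop (rowWord k (G zero)) sp′) (≤-trans (n≤1+n nr) nr≤m) H))))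
        where
        sp′ = subst (Suffix p) (++-assoc (rowWord k (G zero)) _ rest) sp
        i<m : suc (toℕ i) ≤ m
        i<m = ≤-trans (s≤s (<⇒≤ (toℕ<n i))) nr≤m

      -- J runs back to ⋆ while N and X run forward: both gain the position of J.
      copy : ∀ a b {p s} → a + b ≤ m →
        Q (code cellStart) (pos (shift fwd p) rr 0 (a + b) 0 (a + b) s) → Q (code copyTarget) (pos p rr 0 b a b s)
      copy zero    b le q = back refl q
      copy (suc a) b le q =
        back (branch-0 (header-0 (s≤s z≤n) a<m)) (onN (counter-fwd b≤m) (onJ (counter-bwd (<⇒≤ a<m)) (onX (counter-fwd b≤m)
          (copy a (suc b) (subst (_≤ m) (sym (+-suc a b)) le) (onN (+-suc a b) (onX (+-suc a b) q))))))
        where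
        a<m : suc a ≤ m
        a<m = ≤-trans (m≤m+n (suc a) b) le
        b≤m : b ≤ m
        b≤m = ≤-trans (m≤n+m b (suc a)) le

      -- X counts down the columns before column j while P moves along the row;
      -- when X reads ⋆, P stands on the entry of column j.
      seek-cell : ∀ kk f rest p (j : Fin (suc kk)) {n s} → Suffix p (rowWord kk f ++ rest) → kk ≤ k →
        (∀ pe → tp pe ≡ bitSym (f j) → pe < L → Q (code seekCell) (pos pe rr 0 n 0 0 s)) →
        Q (code seekCell) (pos (suc p) rr 0 n 0 (toℕ j) s)
      seek-cell zero     f rest p zero    sp _    H = H (suc p) (suffix-head sp) (suffix-< (suffix-tail sp))
      seek-cell (suc kk) f rest p zero    sp _    H = H (suc p) (suffix-head sp) (suffix-< (suffix-tail sp))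
      seek-cell (suc kk) f rest p (suc j) sp kk<k H =
        back (branch-0 (header-0 (s≤s z≤n) j<m)) (onP (shift-fwd (suffix-< (suffix-tail sp)))
          (back refl (onP (shift-fwd (suffix-<-row kk _ rest next)) (back refl (onX (counter-bwd (<⇒≤ j<m))
            (seek-cell kk (λ i → f (suc i)) rest (suc (suc p)) j next (≤-trans (n≤1+n kk) kk<k) H))))))
        where
        next = suffix-tail (suffix-tail sp)
        j<m : suc (toℕ j) ≤ m
        j<m = s≤s (≤-trans (≤-pred (toℕ<n j)) (≤-trans (n≤1+n kk) kk<k))

      rewind-tape : ∀ d y {n s} → d + y ≡ L → 1 ≤ y →
        Q (code atNode) (pos 0 rr 0 (shift fwd n) 0 0 s) → Q (code rewind) (pos y rr 0 n 0 0 s)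
      rewind-tape zero    y refl 1≤y q = back (branch-bit (proj₂ (inWord 1≤y ≤-refl))) (onP shift-fwd-end (back refl q))
      rewind-tape (suc d) y e    1≤y q =
        back (branch-bit (proj₂ (inWord 1≤y (<⇒≤ y<L)))) (onP (shift-fwd y<L) (rewind-tape d (suc y) (trans (+-suc d y) e) (s≤s z≤n) q))
        where
        y<L : y < L
        y<L = counter-≤ (trans (+-suc d y) e)

      lookup-entry : ∀ (i j : Fin m) s →
        (∀ pe → tp pe ≡ bitSym (A i j) → pe < L → Q (code seekCell) (pos pe rr 0 (suc (toℕ j)) 0 0 s)) →
        Q (code seekMatrix) (pos 1 rr 0 (suc (toℕ i)) (suc (toℕ j)) 0 s)
      lookup-entry i j s H =
        seek-matrix m 1 (+-comm m 1) (s≤s z≤n) (onN (counter-bwd (<⇒≤ (toℕ<n i)))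
          (skip-rows m A i (suc m) [] rows-suffix′ ≤-refl at-row))
        where
        tj = toℕ j
        rows-suffix′ : Suffix (suc m) (rowsWord k m A ++ [])
        rows-suffix′ = subst (Suffix (suc m)) (sym (++-identityʳ _)) rows-suffix
        -- On row i, N reads ⋆: J is copied into N and X, and X selects column j.
        at-row : ∀ p′ rest′ → Suffix p′ (rowWord k (A i) ++ rest′) → Q (code seekRow) (pos p′ rr 0 0 (suc tj) 0 s)
        at-row p′ rest′ sp′ =
          back refl (onN (shift-fwd 0<L) (onJ (counter-bwd (<⇒≤ (toℕ<n j))) (onX (shift-fwd 0<L)
            (copy tj 1 (subst (_≤ m) (+-comm 1 tj) (toℕ<n j))
              (onP (shift-fwd (suffix-<-row k _ _ sp′)) (onN (+-comm tj 1) (onX (+-comm tj 1)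
                (back refl (onX (counter-bwd (<⇒≤ (toℕ<n j))) (seek-cell k (A i) rest′ p′ j sp′ ≤-refl H))))))))))

      follow-edge : ∀ (j : Fin m) s pe → tp pe ≡ s1 → pe < L →
        Q (code atNode) (pos 0 rr 0 (suc (suc (toℕ j))) 0 0 s) → Q (code seekCell) (pos pe rr 0 (suc (toℕ j)) 0 0 s)
      follow-edge j s pe h pe<L q =
        back (branch-1 h) (onP (shift-fwd pe<L) (rewind-tape (L ∸ suc pe) (suc pe) (m∸n+n≡m pe<L) (s≤s z≤n)
          (onN (counter-fwd (toℕ<n j)) q)))

      edge-step : ∀ (i j : Fin m) s → A i j ≡ true →
        Q (code atNode) (pos 0 rr 0 (suc (suc (toℕ j))) 0 0 s) → Q (code seekMatrix) (pos 1 rr 0 (suc (toℕ i)) (suc (toℕ j)) 0 s)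
      edge-step i j s edge q = lookup-entry i j s (λ pe h pe<L → follow-edge j s pe (trans h (cong bitSym edge)) pe<L q)

    module GoodSteps = Steps Good good-back
    module RejectingSteps = Steps Rejecting rejecting-back

    -- N reads 0 on the cell of every node but the last, which reads 1.
    not-last : ∀ (i : Fin m) → i ≢ fromℕ k → suc (suc (toℕ i)) ≤ m
    not-last i i≢last with m≤n⇒m<n∨m≡n (≤-pred (toℕ<n i))
    ... | inj₁ i<k = s≤s i<k
    ... | inj₂ i≡k = ⊥-elim (i≢last (toℕ-injective (trans i≡k (sym (toℕ-fromℕ k)))))

    last-reads-1 : ∀ {i : Fin m} → i ≡ fromℕ k → tp (suc (suc (toℕ i))) ≡ s1
    last-reads-1 refl = subst (λ z → tp (suc (suc z)) ≡ s1) (sym (toℕ-fromℕ k)) header-1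

    -- If the last node is unreachable, every branch of the walk accepts: from a
    -- reachable node with b steps of budget left, each branch either runs out
    -- of budget, guesses a non-edge, or follows an edge to a reachable node.
    walk-good : ∀ b s (i : Fin m) → b + s ≡ m → Star (Edge A) zero i → ¬ HasPath1m k A →
                Good (code atNode) (pos 0 rr 0 (suc (suc (toℕ i))) 0 0 s)
    walk-good zero s i refl reach noPath =
      good-back (branch-0 (header-0 (s≤s z≤n) i+2≤m)) (onN (counter-bwd (<⇒≤ i+2≤m))
        (good-back refl (onK (counter-fwd ≤-refl) (good-accept (branch-1 header-1)))))
      where
      open Reposition Good
      i+2≤m = not-last i (λ i≡last → noPath (subst (Star (Edge A) zero) i≡last reach))
    walk-good (suc b) s i e reach noPath =
      GoodSteps.to-guess i s i+2≤m s<m (guesses m 1 (+-comm m 1) (s≤s z≤n))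
      where
      open Reposition Good
      i+2≤m = not-last i (λ i≡last → noPath (subst (Star (Edge A) zero) i≡last reach))
      s<m : s < m
      s<m = counter-≤ (trans (+-suc b s) e)
      entry : ∀ (j : Fin m) pe → tp pe ≡ bitSym (A i j) → pe < L →
              Good (code seekCell) (pos pe rr 0 (suc (toℕ j)) 0 0 (suc s))
      entry j pe h pe<L with A i j in edge
      ... | true  = GoodSteps.follow-edge j (suc s) pe h pe<L
                      (walk-good b (suc s) j (trans (+-suc b s) e) (reach ◅◅ (edge ◅ ε)) noPath)
      ... | false = good-accept (branch-0 h)
      -- with J on cell y, either J moves on or node y − 1 is taken as successor
      guesses : ∀ d y → d + y ≡ suc m → 1 ≤ y → Good (code guess) (pos 0 rr 0 (suc (toℕ i)) y 0 (suc s))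
      guesses zero    y       refl _ = good-accept (branch-1 header-1)
      guesses (suc d) (suc y) e    _ =
        good-step _ _ (branch-0 (header-0 (s≤s z≤n) y<m))
          (onJ (counter-fwd y<m) (guesses d (suc (suc y)) (trans (+-suc d (suc y)) e) (s≤s z≤n)) ∷
           onP (shift-fwd 0<L) (onJ (cong suc (sym (toℕ-fromℕ< y<m)))
             (GoodSteps.lookup-entry i (fromℕ< y<m) (suc s) (entry (fromℕ< y<m)))) ∷ [])
        where
        y<m : suc y ≤ m
        y<m = counter-≤ (suc-injective e)

    -- Along a walk f of length ℓ < m that ends in the last node, the branch
    -- guessing the successors f (t + 1) rejects.
    module _ (f : ℕ → Fin m) (ℓ : ℕ) (end : f ℓ ≡ fromℕ k)
             (edges : ∀ t → t < ℓ → A (f t) (f (suc t)) ≡ true) (ℓ<m : ℓ < m) where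
      open Reposition Rejecting

      walk-rejecting : ∀ d t → d + t ≡ ℓ → Rejecting (code atNode) (pos 0 rr 0 (suc (suc (toℕ (f t)))) 0 0 t)
      walk-rejecting d t e with f t F.≟ fromℕ k
      ... | yes last = rejecting-step _ _ (branch-1 (last-reads-1 last)) (here refl) tt
      walk-rejecting zero    t e | no notLast = ⊥-elim (notLast (trans (cong f e) end))
      walk-rejecting (suc d) t e | no notLast =
        RejectingSteps.to-guess (f t) t (not-last (f t) notLast) (≤-trans t<ℓ (<⇒≤ ℓ<m))
          (guess-next (toℕ (f (suc t))) 1 (+-comm (toℕ (f (suc t))) 1) (s≤s z≤n))
        where
        t<ℓ : t < ℓ
        t<ℓ = counter-≤ (trans (+-suc d t) e)
        next = f (suc t)
        guess-next : ∀ d′ y → d′ + y ≡ suc (toℕ next) → 1 ≤ y →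
                     Rejecting (code guess) (pos 0 rr 0 (suc (toℕ (f t))) y 0 (suc t))
        guess-next zero     y refl 1≤y =
          rejecting-step _ _ (branch-0 (header-0 1≤y (toℕ<n next))) (there (here refl))
            (onP (shift-fwd 0<L) (RejectingSteps.edge-step (f t) next (suc t) (edges t t<ℓ)
              (walk-rejecting d (suc t) (trans (+-suc d t) e))))
        guess-next (suc d′) y e′   1≤y =
          rejecting-step _ _ (branch-0 (header-0 1≤y y≤m)) (here refl)
            (onJ (counter-fwd y≤m) (guess-next d′ (suc y) (trans (+-suc d′ y) e′) (s≤s z≤n)))
          where
          y≤m : y ≤ m
          y≤m = ≤-trans (counter-≤ (suc-injective e′)) (<⇒≤ (toℕ<n next))

  connected-rejecting : EncodesConnected w → Rejecting (code start) (pos 0 0 0 0 0 0 0)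
  connected-rejecting (k , A , w≡enc , path) with Walks.shortWalk (Edge A) path
  ... | ℓ , ℓ<m , f , f0 , fend , edges =
    header-run (rows-run (suc k) A (suc m) 1 rows-suffix (cong suc (+-comm k 1)) (s≤s z≤n)
      (rejecting-back refl (onN (counter-fwd (s≤s z≤n))
        (subst (λ i → Rejecting (code atNode) (pos 0 (suc m) 0 (suc (suc (toℕ i))) 0 0 0)) f0
          (walk-rejecting f ℓ fend edges ℓ<m ℓ 0 (+-identityʳ ℓ))))))
    where
    w≡ = trans w≡enc (encode-rows k A)
    open Header k (rowsWord k (suc k) A) w≡ using (m; rows-suffix; counter-fwd)
    open Header.Validation k (rowsWord k (suc k) A) w≡ Rejecting rejecting-back
    open Walk k A w≡ using (walk-rejecting)

  disconnected-good : STConnComp w → Good (code start) (pos 0 0 0 0 0 0 0)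
  disconnected-good noPath = validation-good at-walk
    where
    at-walk : ∀ k G → w ≡ replicate (suc k) false ++ true ∷ rowsWord k (suc k) G →
              Good (code walkStart) (pos 0 (suc (suc k)) 0 1 0 0 0)
    at-walk k G w≡ =
      good-back refl (onN (counter-fwd (s≤s z≤n))
        (walk-good (suc k) 0 zero (+-identityʳ (suc k)) ε (λ path → noPath (k , G , trans w≡ (sym (encode-rows k G)) , path))))
      where
      open Header k (rowsWord k (suc k) G) w≡ using (counter-fwd; onN)
      open Walk k G w≡ using (walk-good)

-- M started in c₀ accepts w exactly when w ∈ STConnComp: the initial
-- configuration is the consistent one with all pointers on cell 0.
accepts-iff : ∀ w → Accepts M c₀ w → STConnComp w
accepts-iff w (t , accepted) connected =
  OnWord.connected-rejecting w connected (V.replicate 7 zero) refl t accepted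

STConnComp-accepted : ∀ w → STConnComp w → Accepts M c₀ w
STConnComp-accepted w noPath = t , accepted (V.replicate 7 zero) refl
  where
  open OnWord w using (disconnected-good)
  t = proj₁ (disconnected-good noPath)
  accepted = proj₂ (disconnected-good noPath)

proposition5 : InNDPM STConnComp
proposition5 = 6 , 24 , M , c₀ , λ w → mk⇔ (accepts-iff w) (STConnComp-accepted w)
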